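{- For every integer $k\ge 2$, as formal power series in $q$, $$\sum_{n\ge 0} \frac{(q^{2n+2}, q^{2n+2k}; q^2)_\infty}{(q^{2n+1};q^2)_\infty^2}\, q^{2n} = \sum_{n=0}^{k-2} \begin{bmatrix} k-2\\ n\end{bmatrix}_{q^2} \frac{(q^2;q^2)_n\, q^{2n^2+2n}}{(q;q^2)_{n+1}^2}.$$
   Context: For $n\in\mathbb{N}\cup\{\infty\}$, $(A;q)_n := \prod_{j=0}^{n-1}(1-Aq^j)$, and $(A_1,\dots,A_m;q)_n := (A_1;q)_n\cdots(A_m;q)_n$. The $q$-binomial coefficient is $\begin{bmatrix} M\\ N\end{bmatrix}_q := \frac{(q;q)_M}{(q;q)_N (q;q)_{M-N}}$ for $0\le N\le M$ and $0$ otherwise; $\begin{bmatrix} M\\ N\end{bmatrix}_{q^2}$ denotes this with $q$ replaced by $q^2$. -}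

module Defs where

open import Data.Nat using (ℕ; zero; suc; _∸_; _≤ᵇ_; _≡ᵇ_) renaming (_+_ to _+ℕ_; _*_ to _*ℕ_)
open import Data.Integer using (ℤ; _+_; _*_; -_; 0ℤ; 1ℤ)
open import Data.Bool using (if_then_else_)

PS : Set
PS = ℕ → ℤ

Σ< : ℕ → (ℕ → ℤ) → ℤ
Σ< zero    h = 0ℤ
Σ< (suc n) h = Σ< n h + h n

mono : ℕ → PS
mono a m = if m ≡ᵇ a then 1ℤ else 0ℤ

one zeroS : PS
one = mono 0
zeroS _ = 0ℤ

_⊕_ _⊖_ _⊗_ : PS → PS → PS
(f ⊕ g) m = f m + g m
(f ⊖ g) m = f m + - g m
(f ⊗ g) m = Σ< (suc m) (λ i → f i * g (m ∸ i))

infixl 6 _⊕_ _⊖_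
infixl 7 _⊗_ _⊘_

pow : PS → ℕ → PS
pow f zero    = one
pow f (suc k) = pow f k ⊗ f

-- multiplicative inverse of a series with constant term 1:
-- 1/f = Σ_{k ≥ 0} (1 - f)^k ; (1-f)^k has order ≥ k, so the coefficient
-- of q^m only involves k ≤ m.
inv : PS → PS
inv f m = Σ< (suc m) (λ k → pow (one ⊖ f) k m)

_⊘_ : PS → PS → PS
f ⊘ g = f ⊗ inv g

prodS : (ℕ → PS) → ℕ → PS
prodS F zero    = one
prodS F (suc n) = prodS F n ⊗ F n

poch : ℕ → ℕ → ℕ → PS
poch a b n = prodS (λ j → one ⊖ mono (a +ℕ b *ℕ j)) n

-- infinite q-Pochhammer (q^a ; q^b)_∞ for b ≥ 1: factors with j ≥ m+1
-- have a + b j > m and do not affect the coefficient of q^m.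
pochInf : ℕ → ℕ → PS
pochInf a b m = poch a b (suc m) m

qbin2 : ℕ → ℕ → PS
qbin2 M N = if N ≤ᵇ M
  then poch 2 2 M ⊘ (poch 2 2 N ⊗ poch 2 2 (M ∸ N))
  else zeroS

lhsTerm : ℕ → ℕ → PS
lhsTerm k n =
  (pochInf (2 *ℕ n +ℕ 2) 2 ⊗ pochInf (2 *ℕ n +ℕ 2 *ℕ k) 2)
    ⊘ (pochInf (2 *ℕ n +ℕ 1) 2 ⊗ pochInf (2 *ℕ n +ℕ 1) 2)
    ⊗ mono (2 *ℕ n)

-- the n-th term has order ≥ 2n ≥ n, so only n ≤ m contribute to q^m
lhs : ℕ → PS
lhs k m = Σ< (suc m) (λ n → lhsTerm k n m)

rhsTerm : ℕ → ℕ → PS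
rhsTerm k n =
  qbin2 (k ∸ 2) n ⊗ poch 2 2 n ⊗ mono (2 *ℕ n *ℕ n +ℕ 2 *ℕ n)
    ⊘ (poch 1 2 (suc n) ⊗ poch 1 2 (suc n))

rhs : ℕ → PS
rhs k m = Σ< (suc (k ∸ 2)) (λ n → rhsTerm k n m)

{-# OPTIONS --safe #-}
module Submission where

-- Both sides, as functions X of k, satisfy
--   (1 - q^{2k-3})² X k = (1 - q^{2k-4}) X (k - 1) + q^{2k-4}    (k ≥ 2),
-- and this determines X k for k ≥ 2: at k = 2 the coefficient of X 1 vanishes, and
-- series with constant term 1 can be cancelled. On each side the recurrence holds
-- termwise up to a telescoping difference. On the left the n-th terms differ by
-- q^{2k-4} (V (n+1) - V n) with V n = (q^{2n}, q^{2n+2k-2}; q²)_∞ / (q^{2n+1}; q²)_∞²,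
-- which is 0 at n = 0 and tends to 1. On the right, with M = k - 2, they differ by
-- q^{2M} (U j - U (j+1)) with U j = [M j]_{q²} (q²;q²)_j q^{2j²} / (q;q²)_j², which is
-- 1 at j = 0 and 0 at j = M + 1. Once the q-shifts of the Pochhammer symbols are
-- substituted, each termwise statement is a polynomial identity.

open import Data.Nat using (ℕ; zero; suc; _∸_; _≤_; _<_; z≤n; s≤s; _≡ᵇ_; _≤ᵇ_) renaming (_+_ to _+ℕ_; _*_ to _*ℕ_)
import Data.Nat.Properties as ℕ
import Data.Nat.Tactic.RingSolver as ℕ-Solver
open import Data.Integer using (ℤ; _+_; _*_; -_; 0ℤ; 1ℤ; +-*-rawRing)
import Data.Integer as ℤ
import Data.Integer.Properties as ℤ
open import Data.Integer.Tactic.RingSolver using (solve-∀)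
open import Data.Bool using (true; false; T)
open import Data.Unit using (tt)
open import Data.Empty using (⊥-elim)
open import Data.Maybe using (Maybe; just; nothing)
open import Data.Product using (_,_)
open import Data.Sum using (inj₁; inj₂)
open import Level using (0ℓ)
open import Relation.Binary.PropositionalEquality using (_≡_; refl; sym; trans; cong; cong₂; subst; module ≡-Reasoning)
open import Relation.Binary.Bundles using (Setoid)
import Relation.Binary.Reasoning.Setoid
open import Relation.Nullary using (¬_; yes; no)
open import Algebra.Bundles using (CommutativeRing)
open import Algebra.Solver.Ring.AlmostCommutativeRing using (fromCommutativeRing; _-Raw-AlmostCommutative⟶_)
open import Defs

-- Finite sums

Σ<-cong : ∀ n {h h′ : ℕ → ℤ} → (∀ i → i < n → h i ≡ h′ i) → Σ< n h ≡ Σ< n h′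
Σ<-cong zero    eq = refl
Σ<-cong (suc n) eq = cong₂ _+_ (Σ<-cong n (λ i i<n → eq i (ℕ.m<n⇒m<1+n i<n))) (eq n ℕ.≤-refl)

Σ<-zero : ∀ n {h : ℕ → ℤ} → (∀ i → i < n → h i ≡ 0ℤ) → Σ< n h ≡ 0ℤ
Σ<-zero zero    eq = refl
Σ<-zero (suc n) eq = cong₂ _+_ (Σ<-zero n (λ i i<n → eq i (ℕ.m<n⇒m<1+n i<n))) (eq n ℕ.≤-refl)

Σ<-+ : ∀ n (h h′ : ℕ → ℤ) → Σ< n (λ i → h i + h′ i) ≡ Σ< n h + Σ< n h′
Σ<-+ zero    h h′ = refl
Σ<-+ (suc n) h h′ rewrite Σ<-+ n h h′ = interchange (Σ< n h) (Σ< n h′) (h n) (h′ n)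
  where
  interchange : ∀ a b c d → a + b + (c + d) ≡ a + c + (b + d)
  interchange = solve-∀

Σ<-*ˡ : ∀ n a (h : ℕ → ℤ) → Σ< n (λ i → a * h i) ≡ a * Σ< n h
Σ<-*ˡ zero    a h = sym (ℤ.*-zeroʳ a)
Σ<-*ˡ (suc n) a h rewrite Σ<-*ˡ n a h = sym (ℤ.*-distribˡ-+ a (Σ< n h) (h n))

Σ<-*ʳ : ∀ n a (h : ℕ → ℤ) → Σ< n (λ i → h i * a) ≡ Σ< n h * a
Σ<-*ʳ zero    a h = refl
Σ<-*ʳ (suc n) a h rewrite Σ<-*ʳ n a h = sym (ℤ.*-distribʳ-+ a (Σ< n h) (h n))

Σ<-head : ∀ n (h : ℕ → ℤ) → Σ< (suc n) h ≡ h 0 + Σ< n (λ i → h (suc i))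
Σ<-head zero    h = ℤ.+-comm 0ℤ (h 0)
Σ<-head (suc n) h rewrite Σ<-head n h = ℤ.+-assoc (h 0) _ _

Σ<-reverse : ∀ n (h : ℕ → ℤ) → Σ< n h ≡ Σ< n (λ i → h (n ∸ suc i))
Σ<-reverse zero    h = refl
Σ<-reverse (suc n) h = begin
  Σ< n h + h n                       ≡⟨ cong (_+ h n) (Σ<-reverse n h) ⟩
  Σ< n (λ i → h (n ∸ suc i)) + h n   ≡⟨ ℤ.+-comm _ (h n) ⟩
  h n + Σ< n (λ i → h (n ∸ suc i))   ≡⟨ Σ<-head n (λ i → h (suc n ∸ suc i)) ⟨
  Σ< (suc n) (λ i → h (suc n ∸ suc i)) ∎
  where open ≡-Reasoning

Σ<-extend : ∀ {n} n′ (h : ℕ → ℤ) → n ≤ n′ → (∀ i → n ≤ i → h i ≡ 0ℤ) → Σ< n′ h ≡ Σ< n h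
Σ<-extend zero     h z≤n   vanish = refl
Σ<-extend {n} (suc n′) h n≤1+n′ vanish with n ℕ.≟ suc n′
... | yes refl = refl
... | no n≢1+n′ = trans (cong₂ _+_ (Σ<-extend n′ h n≤n′ vanish) (vanish n′ n≤n′)) (ℤ.+-identityʳ _)
  where
  n≤n′ : n ≤ n′
  n≤n′ = ℕ.≤-pred (ℕ.≤∧≢⇒< n≤1+n′ n≢1+n′)

Σ<-triangle : ∀ n (F : ℕ → ℕ → ℤ) →
  Σ< n (λ i → Σ< (suc i) (λ j → F j i)) ≡ Σ< n (λ j → Σ< (n ∸ j) (λ l → F j (j +ℕ l)))
Σ<-triangle zero    F = refl
Σ<-triangle (suc n) F = begin
  Σ< n (λ i → Σ< (suc i) (λ j → F j i)) + Σ< (suc n) (λ j → F j n)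
    ≡⟨ cong (_+ Σ< (suc n) (λ j → F j n)) (Σ<-triangle n F) ⟩
  Σ< n row + Σ< (suc n) (λ j → F j n)
    ≡⟨ cong (_+ Σ< (suc n) (λ j → F j n)) (trans (cong (Σ< n row +_) row-last) (ℤ.+-identityʳ (Σ< n row))) ⟨
  Σ< (suc n) row + Σ< (suc n) (λ j → F j n)
    ≡⟨ Σ<-+ (suc n) row (λ j → F j n) ⟨
  Σ< (suc n) (λ j → row j + F j n)
    ≡⟨ Σ<-cong (suc n) extend-row ⟩
  Σ< (suc n) (λ j → Σ< (suc n ∸ j) (λ l → F j (j +ℕ l))) ∎
  where
  open ≡-Reasoning
  row : ℕ → ℤ
  row j = Σ< (n ∸ j) (λ l → F j (j +ℕ l))
  row-last : row n ≡ 0ℤ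
  row-last = cong (λ r → Σ< r (λ l → F n (n +ℕ l))) (ℕ.n∸n≡0 n)
  extend-row : ∀ j → j < suc n → row j + F j n ≡ Σ< (suc n ∸ j) (λ l → F j (j +ℕ l))
  extend-row j (s≤s j≤n) rewrite ℕ.+-∸-assoc 1 j≤n = cong (λ i → row j + F j i) (sym (ℕ.m+[n∸m]≡n j≤n))

mono-same : ∀ a → mono a a ≡ 1ℤ
mono-same a with a ≡ᵇ a in eq
... | true  = refl
... | false = ⊥-elim (subst T eq (ℕ.≡⇒≡ᵇ a a refl))

mono-other : ∀ a m → ¬ m ≡ a → mono a m ≡ 0ℤ
mono-other a m m≢a with m ≡ᵇ a in eq
... | true  = ⊥-elim (m≢a (ℕ.≡ᵇ⇒≡ m a (subst T (sym eq) tt)))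
... | false = refl

Σ<-mono-*-out : ∀ n a (h : ℕ → ℤ) → n ≤ a → Σ< n (λ i → mono a i * h i) ≡ 0ℤ
Σ<-mono-*-out n a h n≤a = Σ<-zero n (λ i i<n →
  cong (_* h i) (mono-other a i (λ i≡a → ℕ.<-irrefl i≡a (ℕ.<-≤-trans i<n n≤a))))

Σ<-mono-* : ∀ n a (h : ℕ → ℤ) → a < n → Σ< n (λ i → mono a i * h i) ≡ h a
Σ<-mono-* (suc n) a h a<1+n with ℕ.m<1+n⇒m<n∨m≡n a<1+n
... | inj₁ a<n = begin
  Σ< n (λ i → mono a i * h i) + mono a n * h n
    ≡⟨ cong₂ _+_ (Σ<-mono-* n a h a<n) (cong (_* h n) (mono-other a n (λ n≡a → ℕ.<-irrefl (sym n≡a) a<n))) ⟩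
  h a + 0ℤ * h n
    ≡⟨ ℤ.+-identityʳ (h a) ⟩
  h a ∎
  where open ≡-Reasoning
... | inj₂ refl = begin
  Σ< a (λ i → mono a i * h i) + mono a a * h a
    ≡⟨ cong₂ _+_ (Σ<-mono-*-out a a h ℕ.≤-refl) (cong (_* h a) (mono-same a)) ⟩
  0ℤ + 1ℤ * h a
    ≡⟨ trans (ℤ.+-identityˡ _) (ℤ.*-identityˡ (h a)) ⟩
  h a ∎
  where open ≡-Reasoning

-- The power series ring

neg : PS → PS
neg f m = - f m

infix 4 _≈_
record _≈_ (f g : PS) : Set where
  constructor mk
  field at : ∀ m → f m ≡ g m
open _≈_ public

≈-refl : ∀ {f} → f ≈ f
≈-refl = mk (λ m → refl)

≈-sym : ∀ {f g} → f ≈ g → g ≈ f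
≈-sym (mk p) = mk (λ m → sym (p m))

≈-trans : ∀ {f g h} → f ≈ g → g ≈ h → f ≈ h
≈-trans (mk p) (mk q) = mk (λ m → trans (p m) (q m))

≡⇒≈ : ∀ {f g} → f ≡ g → f ≈ g
≡⇒≈ refl = ≈-refl

mono-⊗-coeff : ∀ a f m → a ≤ m → (mono a ⊗ f) m ≡ f (m ∸ a)
mono-⊗-coeff a f m a≤m = Σ<-mono-* (suc m) a (λ i → f (m ∸ i)) (s≤s a≤m)

mono-⊗-coeff-low : ∀ a f m → m < a → (mono a ⊗ f) m ≡ 0ℤ
mono-⊗-coeff-low a f m m<a = Σ<-mono-*-out (suc m) a (λ i → f (m ∸ i)) m<a

⊕-cong : ∀ {f f′ g g′} → f ≈ f′ → g ≈ g′ → f ⊕ g ≈ f′ ⊕ g′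
⊕-cong (mk p) (mk q) = mk (λ m → cong₂ _+_ (p m) (q m))

neg-cong : ∀ {f f′} → f ≈ f′ → neg f ≈ neg f′
neg-cong (mk p) = mk (λ m → cong -_ (p m))

⊗-cong : ∀ {f f′ g g′} → f ≈ f′ → g ≈ g′ → f ⊗ g ≈ f′ ⊗ g′
⊗-cong (mk p) (mk q) = mk (λ m → Σ<-cong (suc m) (λ i _ → cong₂ _*_ (p i) (q (m ∸ i))))

⊕-congˡ : ∀ f {g g′} → g ≈ g′ → f ⊕ g ≈ f ⊕ g′
⊕-congˡ f = ⊕-cong (≈-refl {f})

⊕-congʳ : ∀ {f f′} g → f ≈ f′ → f ⊕ g ≈ f′ ⊕ g
⊕-congʳ g p = ⊕-cong p (≈-refl {g})

⊗-congˡ : ∀ f {g g′} → g ≈ g′ → f ⊗ g ≈ f ⊗ g′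
⊗-congˡ f = ⊗-cong (≈-refl {f})

⊗-congʳ : ∀ {f f′} g → f ≈ f′ → f ⊗ g ≈ f′ ⊗ g
⊗-congʳ g p = ⊗-cong p (≈-refl {g})

⊗-comm : ∀ f g → f ⊗ g ≈ g ⊗ f
⊗-comm f g = mk λ m → trans (Σ<-reverse (suc m) (λ i → f i * g (m ∸ i)))
  (Σ<-cong (suc m) (λ i i≤m → trans (cong (λ j → f (m ∸ i) * g j) (ℕ.m∸[m∸n]≡n (ℕ.≤-pred i≤m)))
                                    (ℤ.*-comm (f (m ∸ i)) (g i))))

⊗-assoc : ∀ f g h → (f ⊗ g) ⊗ h ≈ f ⊗ (g ⊗ h)
⊗-assoc f g h = mk λ m → begin
  Σ< (suc m) (λ i → Σ< (suc i) (λ j → f j * g (i ∸ j)) * h (m ∸ i))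
    ≡⟨ Σ<-cong (suc m) (λ i _ → Σ<-*ʳ (suc i) (h (m ∸ i)) (λ j → f j * g (i ∸ j))) ⟨
  Σ< (suc m) (λ i → Σ< (suc i) (λ j → f j * g (i ∸ j) * h (m ∸ i)))
    ≡⟨ Σ<-triangle (suc m) (λ j i → f j * g (i ∸ j) * h (m ∸ i)) ⟩
  Σ< (suc m) (λ j → Σ< (suc m ∸ j) (λ l → f j * g ((j +ℕ l) ∸ j) * h (m ∸ (j +ℕ l))))
    ≡⟨ Σ<-cong (suc m) (inner m) ⟩
  Σ< (suc m) (λ j → f j * Σ< (suc (m ∸ j)) (λ l → g l * h ((m ∸ j) ∸ l))) ∎
  where
  open ≡-Reasoning
  inner : ∀ m j → j < suc m →
    Σ< (suc m ∸ j) (λ l → f j * g ((j +ℕ l) ∸ j) * h (m ∸ (j +ℕ l)))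
      ≡ f j * Σ< (suc (m ∸ j)) (λ l → g l * h ((m ∸ j) ∸ l))
  inner m j (s≤s j≤m) rewrite ℕ.+-∸-assoc 1 j≤m = trans
    (Σ<-cong (suc (m ∸ j)) (λ l _ →
      trans (cong₂ (λ u v → f j * g u * h v) (ℕ.m+n∸m≡n j l) (sym (ℕ.∸-+-assoc m j l)))
            (ℤ.*-assoc (f j) (g l) (h ((m ∸ j) ∸ l)))))
    (Σ<-*ˡ (suc (m ∸ j)) (f j) (λ l → g l * h ((m ∸ j) ∸ l)))

⊗-identityˡ : ∀ f → one ⊗ f ≈ f
⊗-identityˡ f = mk λ m → mono-⊗-coeff 0 f m z≤n

⊗-identityʳ : ∀ f → f ⊗ one ≈ f
⊗-identityʳ f = ≈-trans (⊗-comm f one) (⊗-identityˡ f)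

⊗-distribˡ-⊕ : ∀ f g h → f ⊗ (g ⊕ h) ≈ f ⊗ g ⊕ f ⊗ h
⊗-distribˡ-⊕ f g h = mk λ m →
  trans (Σ<-cong (suc m) (λ i _ → ℤ.*-distribˡ-+ (f i) (g (m ∸ i)) (h (m ∸ i))))
        (Σ<-+ (suc m) (λ i → f i * g (m ∸ i)) (λ i → f i * h (m ∸ i)))

⊗-distribʳ-⊕ : ∀ f g h → (g ⊕ h) ⊗ f ≈ g ⊗ f ⊕ h ⊗ f
⊗-distribʳ-⊕ f g h = ≈-trans (⊗-comm (g ⊕ h) f)
  (≈-trans (⊗-distribˡ-⊕ f g h) (⊕-cong (⊗-comm f g) (⊗-comm f h)))

PS-commutativeRing : CommutativeRing 0ℓ 0ℓ
PS-commutativeRing = record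
  { Carrier = PS ; _≈_ = _≈_ ; _+_ = _⊕_ ; _*_ = _⊗_ ; -_ = neg ; 0# = zeroS ; 1# = one
  ; isCommutativeRing = record
    { isRing = record
      { +-isAbelianGroup = record
        { isGroup = record
          { isMonoid = record
            { isSemigroup = record
              { isMagma = record
                { isEquivalence = record { refl = ≈-refl ; sym = ≈-sym ; trans = ≈-trans }
                ; ∙-cong = ⊕-cong }
              ; assoc = λ f g h → mk (λ m → ℤ.+-assoc (f m) (g m) (h m)) }
            ; identity = (λ f → mk (λ m → ℤ.+-identityˡ (f m))) , (λ f → mk (λ m → ℤ.+-identityʳ (f m))) }
          ; inverse = (λ f → mk (λ m → ℤ.+-inverseˡ (f m))) , (λ f → mk (λ m → ℤ.+-inverseʳ (f m)))
          ; ⁻¹-cong = neg-cong }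
        ; comm = λ f g → mk (λ m → ℤ.+-comm (f m) (g m)) }
      ; *-cong = ⊗-cong
      ; *-assoc = ⊗-assoc
      ; *-identity = ⊗-identityˡ , ⊗-identityʳ
      ; distrib = ⊗-distribˡ-⊕ , ⊗-distribʳ-⊕ }
    ; *-comm = ⊗-comm } }

const : ℤ → PS
const c zero    = c
const c (suc m) = 0ℤ

-- The first two clauses make the solver's constants 0 and 1 evaluate to zeroS and one,
-- so that its equations match goals stated with zeroS and one up to conversion.
constant : ℤ → PS
constant (ℤ.pos 0) = zeroS
constant (ℤ.pos 1) = one
constant c         = const c

constant≈const : ∀ c → constant c ≈ const c
constant≈const c = mk (coeff c)
  where
  coeff : ∀ c m → constant c m ≡ const c m
  coeff (ℤ.pos 0)             zero    = refl
  coeff (ℤ.pos 0)             (suc m) = refl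
  coeff (ℤ.pos 1)             zero    = refl
  coeff (ℤ.pos 1)             (suc m) = refl
  coeff (ℤ.pos (suc (suc n))) m       = refl
  coeff (ℤ.negsuc n)          m       = refl

const-* : ∀ c d → const (c * d) ≈ const c ⊗ const d
const-* c d = mk coeff
  where
  open ≡-Reasoning
  coeff : ∀ m → const (c * d) m ≡ (const c ⊗ const d) m
  coeff zero    = sym (ℤ.+-identityˡ (c * d))
  coeff (suc m) = sym (begin
    Σ< (suc (suc m)) (λ i → const c i * const d (suc m ∸ i))
      ≡⟨ Σ<-head (suc m) (λ i → const c i * const d (suc m ∸ i)) ⟩
    c * 0ℤ + Σ< (suc m) (λ i → 0ℤ * const d (m ∸ i))
      ≡⟨ cong₂ _+_ (ℤ.*-zeroʳ c) (Σ<-zero (suc m) (λ i _ → refl)) ⟩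
    0ℤ ∎)

constant-homomorphism : +-*-rawRing -Raw-AlmostCommutative⟶ fromCommutativeRing PS-commutativeRing
constant-homomorphism = record
  { ⟦_⟧    = constant
  ; +-homo = λ c d → ≈-trans (constant≈const (c + d))
               (≈-trans (mk λ { zero → refl ; (suc m) → refl }) (⊕-cong (≈-sym (constant≈const c)) (≈-sym (constant≈const d))))
  ; *-homo = λ c d → ≈-trans (constant≈const (c * d))
               (≈-trans (const-* c d) (⊗-cong (≈-sym (constant≈const c)) (≈-sym (constant≈const d))))
  ; -‿homo = λ c → ≈-trans (constant≈const (- c))
               (≈-trans (mk λ { zero → refl ; (suc m) → refl }) (neg-cong (≈-sym (constant≈const c))))
  ; 0-homo = ≈-refl
  ; 1-homo = ≈-refl }

constant-≟ : ∀ (c d : ℤ) → Maybe (constant c ≈ constant d)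
constant-≟ c d with c ℤ.≟ d
... | yes refl = just ≈-refl
... | no _     = nothing

open import Algebra.Solver.Ring +-*-rawRing (fromCommutativeRing PS-commutativeRing) constant-homomorphism constant-≟ public
open CommutativeRing PS-commutativeRing public using () renaming (setoid to PS-setoid)
module ≈-Reasoning = Relation.Binary.Reasoning.Setoid PS-setoid

-- Truncations and inverses

infix 4 _≈[_]_
_≈[_]_ : PS → ℕ → PS → Set
f ≈[ m ] g = ∀ j → j ≤ m → f j ≡ g j

≈⇒≈[] : ∀ {f g} m → f ≈ g → f ≈[ m ] g
≈⇒≈[] m (mk p) j _ = p j

≈[]⇒≈ : ∀ {f g} → (∀ m → f ≈[ m ] g) → f ≈ g
≈[]⇒≈ p = mk (λ m → p m m ℕ.≤-refl)

≈[]-refl : ∀ {f} m → f ≈[ m ] f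
≈[]-refl m j _ = refl

≈[]-sym : ∀ {f g} m → f ≈[ m ] g → g ≈[ m ] f
≈[]-sym m p j j≤m = sym (p j j≤m)

≈[]-trans : ∀ {f g h} m → f ≈[ m ] g → g ≈[ m ] h → f ≈[ m ] h
≈[]-trans m p q j j≤m = trans (p j j≤m) (q j j≤m)

≈[]-setoid : ℕ → Setoid 0ℓ 0ℓ
≈[]-setoid m = record
  { Carrier = PS ; _≈_ = _≈[ m ]_
  ; isEquivalence = record { refl = λ {f} → ≈[]-refl {f} m ; sym = ≈[]-sym m ; trans = ≈[]-trans m } }

module ≈[]-Reasoning m = Relation.Binary.Reasoning.Setoid (≈[]-setoid m)

⊕-≈[] : ∀ {f f′ g g′} m → f ≈[ m ] f′ → g ≈[ m ] g′ → f ⊕ g ≈[ m ] f′ ⊕ g′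
⊕-≈[] m p q j j≤m = cong₂ _+_ (p j j≤m) (q j j≤m)

⊖-≈[] : ∀ {f f′ g g′} m → f ≈[ m ] f′ → g ≈[ m ] g′ → f ⊖ g ≈[ m ] f′ ⊖ g′
⊖-≈[] m p q j j≤m = cong₂ _+_ (p j j≤m) (cong -_ (q j j≤m))

⊗-≈[] : ∀ {f f′ g g′} m → f ≈[ m ] f′ → g ≈[ m ] g′ → f ⊗ g ≈[ m ] f′ ⊗ g′
⊗-≈[] m p q j j≤m = Σ<-cong (suc j) (λ i i≤j →
  cong₂ _*_ (p i (ℕ.≤-trans (ℕ.≤-pred i≤j) j≤m)) (q (j ∸ i) (ℕ.≤-trans (ℕ.m∸n≤m j i) j≤m)))

pow-≈[] : ∀ {f g} m k → f ≈[ m ] g → pow f k ≈[ m ] pow g k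
pow-≈[] m zero    p = ≈[]-refl m
pow-≈[] m (suc k) p = ⊗-≈[] m (pow-≈[] m k p) p

inv-≈[] : ∀ {f g} m → f ≈[ m ] g → inv f ≈[ m ] inv g
inv-≈[] m p j j≤m = Σ<-cong (suc j) (λ k _ → pow-≈[] m k (⊖-≈[] m (≈[]-refl {one} m) p) j j≤m)

inv-cong : ∀ {f g} → f ≈ g → inv f ≈ inv g
inv-cong p = ≈[]⇒≈ (λ m → inv-≈[] m (≈⇒≈[] m p))

sumPS : ℕ → (ℕ → PS) → PS
sumPS M F m = Σ< M (λ n → F n m)

sumPS-cong : ∀ M {F G : ℕ → PS} → (∀ n → n < M → F n ≈ G n) → sumPS M F ≈ sumPS M G
sumPS-cong M p = mk λ m → Σ<-cong M (λ n n<M → at (p n n<M) m)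

sumPS-⊕ : ∀ M (F G : ℕ → PS) → sumPS M (λ n → F n ⊕ G n) ≈ sumPS M F ⊕ sumPS M G
sumPS-⊕ M F G = mk λ m → Σ<-+ M (λ n → F n m) (λ n → G n m)

⊗-sumPS : ∀ M f (F : ℕ → PS) → f ⊗ sumPS M F ≈ sumPS M (λ n → f ⊗ F n)
⊗-sumPS zero    f F = solve 1 (λ f → f :* con 0ℤ := con 0ℤ) ≈-refl f
⊗-sumPS (suc M) f F = ≈-trans (⊗-distribˡ-⊕ f (sumPS M F) (F M)) (⊕-congʳ (f ⊗ F M) (⊗-sumPS M f F))

sumPS-telescope : ∀ M (G : ℕ → PS) → sumPS M (λ n → G (suc n) ⊖ G n) ≈ G M ⊖ G 0
sumPS-telescope zero    G = solve 1 (λ g → con 0ℤ := g :- g) ≈-refl (G 0)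
sumPS-telescope (suc M) G = ≈-trans (⊕-congʳ (G (suc M) ⊖ G M) (sumPS-telescope M G))
  (solve 3 (λ g₀ g g′ → (g :- g₀) :+ (g′ :- g) := g′ :- g₀) ≈-refl (G 0) (G M) (G (suc M)))

⊗-sumPS-telescope : ∀ M a b (F F′ G : ℕ → PS) →
  (∀ n → n < M → a ⊗ F′ n ≈ b ⊗ F n ⊕ (G (suc n) ⊖ G n)) →
  a ⊗ sumPS M F′ ≈ b ⊗ sumPS M F ⊕ (G M ⊖ G 0)
⊗-sumPS-telescope M a b F F′ G termwise = begin
  a ⊗ sumPS M F′                                          ≈⟨ ⊗-sumPS M a F′ ⟩
  sumPS M (λ n → a ⊗ F′ n)                                ≈⟨ sumPS-cong M termwise ⟩
  sumPS M (λ n → b ⊗ F n ⊕ (G (suc n) ⊖ G n))             ≈⟨ sumPS-⊕ M (λ n → b ⊗ F n) (λ n → G (suc n) ⊖ G n) ⟩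
  sumPS M (λ n → b ⊗ F n) ⊕ sumPS M (λ n → G (suc n) ⊖ G n) ≈⟨ ⊕-cong (≈-sym (⊗-sumPS M b F)) (sumPS-telescope M G) ⟩
  b ⊗ sumPS M F ⊕ (G M ⊖ G 0)                             ∎
  where open ≈-Reasoning

ConstTermOne : PS → Set
ConstTermOne f = f 0 ≡ 1ℤ

ConstTermOne-⊗ : ∀ f g → ConstTermOne f → ConstTermOne g → ConstTermOne (f ⊗ g)
ConstTermOne-⊗ f g f₀ g₀ = trans (ℤ.+-identityˡ (f 0 * g 0)) (cong₂ _*_ f₀ g₀)

pow-low : ∀ u → u 0 ≡ 0ℤ → ∀ k j → j < k → pow u k j ≡ 0ℤ
pow-low u u₀ (suc k) j j<1+k = Σ<-zero (suc j) term
  where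
  term : ∀ i → i < suc j → pow u k i * u (j ∸ i) ≡ 0ℤ
  term i _ with i ℕ.<? k
  ... | yes i<k = cong (_* u (j ∸ i)) (pow-low u u₀ k i i<k)
  ... | no  i≮k = trans (cong (λ l → pow u k i * u l) (ℕ.m≤n⇒m∸n≡0 j≤i))
                        (trans (cong (pow u k i *_) u₀) (ℤ.*-zeroʳ (pow u k i)))
    where
    j≤i : j ≤ i
    j≤i = ℕ.≤-trans (ℕ.≤-pred j<1+k) (ℕ.≮⇒≥ i≮k)

geometric-sum : ∀ u M → (one ⊖ u) ⊗ sumPS M (pow u) ≈ one ⊖ pow u M
geometric-sum u zero    = solve 1 (λ u → (con 1ℤ :- u) :* con 0ℤ := con 1ℤ :- con 1ℤ) ≈-refl u
geometric-sum u (suc M) = begin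
  (one ⊖ u) ⊗ (sumPS M (pow u) ⊕ pow u M)             ≈⟨ ⊗-distribˡ-⊕ (one ⊖ u) (sumPS M (pow u)) (pow u M) ⟩
  (one ⊖ u) ⊗ sumPS M (pow u) ⊕ (one ⊖ u) ⊗ pow u M   ≈⟨ ⊕-congʳ ((one ⊖ u) ⊗ pow u M) (geometric-sum u M) ⟩
  (one ⊖ pow u M) ⊕ (one ⊖ u) ⊗ pow u M               ≈⟨ solve 2 (λ u p → (con 1ℤ :- p) :+ (con 1ℤ :- u) :* p := con 1ℤ :- p :* u) ≈-refl u (pow u M) ⟩
  one ⊖ pow u M ⊗ u                                   ∎
  where open ≈-Reasoning

-- (1 - f)^k has order ≥ k, so the series defining inv f can be cut off after degree m.
inv-≈[]-geometric : ∀ f → ConstTermOne f → ∀ m → inv f ≈[ m ] sumPS (suc m) (pow (one ⊖ f))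
inv-≈[]-geometric f f₀ m j j≤m = sym (Σ<-extend (suc m) (λ k → pow (one ⊖ f) k j) (s≤s j≤m)
  (λ k j<k → pow-low (one ⊖ f) (cong (λ c → 1ℤ + - c) f₀) k j j<k))

⊗-inverseʳ : ∀ f → ConstTermOne f → f ⊗ inv f ≈ one
⊗-inverseʳ f f₀ = ≈[]⇒≈ up-to
  where
  u : PS
  u = one ⊖ f
  u₀ : u 0 ≡ 0ℤ
  u₀ = cong (λ c → 1ℤ + - c) f₀
  up-to : ∀ m → f ⊗ inv f ≈[ m ] one
  up-to m = begin
    f ⊗ inv f                            ≈⟨ ⊗-≈[] m (≈[]-refl {f} m) (inv-≈[]-geometric f f₀ m) ⟩
    f ⊗ sumPS (suc m) (pow u)            ≈⟨ ≈⇒≈[] m (⊗-congʳ (sumPS (suc m) (pow u)) (solve 1 (λ f → f := con 1ℤ :- (con 1ℤ :- f)) ≈-refl f)) ⟩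
    (one ⊖ u) ⊗ sumPS (suc m) (pow u)    ≈⟨ ≈⇒≈[] m (geometric-sum u (suc m)) ⟩
    one ⊖ pow u (suc m)                  ≈⟨ ⊖-≈[] m (≈[]-refl {one} m) (λ j j≤m → pow-low u u₀ (suc m) j (s≤s j≤m)) ⟩
    one ⊖ zeroS                          ≈⟨ ≈⇒≈[] m (solve 0 (con 1ℤ :- con 0ℤ := con 1ℤ) ≈-refl) ⟩
    one                                  ∎
    where open ≈[]-Reasoning m

⊗-inverseˡ : ∀ f → ConstTermOne f → inv f ⊗ f ≈ one
⊗-inverseˡ f f₀ = ≈-trans (⊗-comm (inv f) f) (⊗-inverseʳ f f₀)

inv-unique : ∀ f g → ConstTermOne f → f ⊗ g ≈ one → g ≈ inv f
inv-unique f g f₀ fg≈1 = begin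
  g                  ≈⟨ ⊗-identityʳ g ⟨
  g ⊗ one            ≈⟨ ⊗-congˡ g (⊗-inverseʳ f f₀) ⟨
  g ⊗ (f ⊗ inv f)    ≈⟨ solve 3 (λ g f i → g :* (f :* i) := (f :* g) :* i) ≈-refl g f (inv f) ⟩
  (f ⊗ g) ⊗ inv f    ≈⟨ ⊗-congʳ (inv f) fg≈1 ⟩
  one ⊗ inv f        ≈⟨ ⊗-identityˡ (inv f) ⟩
  inv f              ∎
  where open ≈-Reasoning

inv-⊗-cancel : ∀ u f → ConstTermOne u → inv u ⊗ (u ⊗ f) ≈ f
inv-⊗-cancel u f u₀ = begin
  inv u ⊗ (u ⊗ f)    ≈⟨ ⊗-assoc (inv u) u f ⟨
  (inv u ⊗ u) ⊗ f    ≈⟨ ⊗-congʳ f (⊗-inverseˡ u u₀) ⟩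
  one ⊗ f            ≈⟨ ⊗-identityˡ f ⟩
  f                  ∎
  where open ≈-Reasoning

⊗-cancelˡ : ∀ u {f g} → ConstTermOne u → u ⊗ f ≈ u ⊗ g → f ≈ g
⊗-cancelˡ u {f} {g} u₀ uf≈ug = begin
  f                  ≈⟨ inv-⊗-cancel u f u₀ ⟨
  inv u ⊗ (u ⊗ f)    ≈⟨ ⊗-congˡ (inv u) uf≈ug ⟩
  inv u ⊗ (u ⊗ g)    ≈⟨ inv-⊗-cancel u g u₀ ⟩
  g                  ∎
  where open ≈-Reasoning

inv-⊗ : ∀ f g → ConstTermOne f → ConstTermOne g → inv (f ⊗ g) ≈ inv f ⊗ inv g
inv-⊗ f g f₀ g₀ = ≈-sym (inv-unique (f ⊗ g) (inv f ⊗ inv g) (ConstTermOne-⊗ f g f₀ g₀) (begin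
  (f ⊗ g) ⊗ (inv f ⊗ inv g)    ≈⟨ solve 4 (λ f g a b → (f :* g) :* (a :* b) := (f :* a) :* (g :* b)) ≈-refl f g (inv f) (inv g) ⟩
  (f ⊗ inv f) ⊗ (g ⊗ inv g)    ≈⟨ ⊗-cong (⊗-inverseʳ f f₀) (⊗-inverseʳ g g₀) ⟩
  one ⊗ one                    ≈⟨ ⊗-identityˡ one ⟩
  one                          ∎))
  where open ≈-Reasoning

inv-one : inv one ≈ one
inv-one = ≈-sym (inv-unique one one refl (⊗-identityˡ one))

inv-extend : ∀ f u → ConstTermOne f → ConstTermOne u → inv f ≈ u ⊗ inv (f ⊗ u)
inv-extend f u f₀ u₀ = ≈-sym (inv-unique f (u ⊗ inv (f ⊗ u)) f₀
  (≈-trans (≈-sym (⊗-assoc f u (inv (f ⊗ u)))) (⊗-inverseʳ (f ⊗ u) (ConstTermOne-⊗ f u f₀ u₀))))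

inv-square-factor : ∀ f Z Z′ → ConstTermOne f → ConstTermOne Z′ → Z ≈ f ⊗ Z′ →
  inv (Z′ ⊗ Z′) ≈ (f ⊗ f) ⊗ inv (Z ⊗ Z)
inv-square-factor f Z Z′ f₀ Z′₀ Z≈fZ′ = begin
  inv (Z′ ⊗ Z′)                          ≈⟨ inv-extend (Z′ ⊗ Z′) (f ⊗ f) (ConstTermOne-⊗ Z′ Z′ Z′₀ Z′₀) (ConstTermOne-⊗ f f f₀ f₀) ⟩
  (f ⊗ f) ⊗ inv ((Z′ ⊗ Z′) ⊗ (f ⊗ f))    ≈⟨ ⊗-congˡ (f ⊗ f) (inv-cong (begin
      (Z′ ⊗ Z′) ⊗ (f ⊗ f)                  ≈⟨ solve 2 (λ z f → (z :* z) :* (f :* f) := (f :* z) :* (f :* z)) ≈-refl Z′ f ⟩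
      (f ⊗ Z′) ⊗ (f ⊗ Z′)                  ≈⟨ ⊗-cong Z≈fZ′ Z≈fZ′ ⟨
      Z ⊗ Z                                ∎)) ⟩
  (f ⊗ f) ⊗ inv (Z ⊗ Z)                  ∎
  where open ≈-Reasoning

-- q-Pochhammer symbols

1-q^_ : ℕ → PS
1-q^ e = one ⊖ mono e

1-q^0≈0 : 1-q^ 0 ≈ zeroS
1-q^0≈0 = mk λ m → ℤ.+-inverseʳ (one m)

1-q^-cong : ∀ {d e} → d ≡ e → 1-q^ d ≈ 1-q^ e
1-q^-cong refl = ≈-refl

mono-cong : ∀ {a b} → a ≡ b → mono a ≈ mono b
mono-cong refl = ≈-refl

1-q^-≈ : ∀ {e} {f} → mono e ≈ f → 1-q^ e ≈ one ⊖ f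
1-q^-≈ p = ⊕-congˡ one (neg-cong p)

ConstTermOne-1-q^ : ∀ {e} → 0 < e → ConstTermOne (1-q^ e)
ConstTermOne-1-q^ {e} 0<e = cong (λ c → 1ℤ + - c) (mono-other e 0 (λ 0≡e → ℕ.<-irrefl 0≡e 0<e))

mono-+ : ∀ i j → mono (i +ℕ j) ≈ mono i ⊗ mono j
mono-+ i j = mk coeff
  where
  coeff : ∀ m → mono (i +ℕ j) m ≡ (mono i ⊗ mono j) m
  coeff m with i ℕ.≤? m
  ... | no i≰m = trans (mono-other (i +ℕ j) m (λ m≡i+j → i≰m (ℕ.≤-trans (ℕ.m≤m+n i j) (ℕ.≤-reflexive (sym m≡i+j)))))
                       (sym (mono-⊗-coeff-low i (mono j) m (ℕ.≰⇒> i≰m)))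
  ... | yes i≤m with m ℕ.≟ i +ℕ j
  ...   | yes refl = trans (mono-same (i +ℕ j))
                       (sym (trans (mono-⊗-coeff i (mono j) (i +ℕ j) i≤m) (trans (cong (mono j) (ℕ.m+n∸m≡n i j)) (mono-same j))))
  ...   | no m≢i+j = trans (mono-other (i +ℕ j) m m≢i+j)
                       (sym (trans (mono-⊗-coeff i (mono j) m i≤m)
                         (mono-other j (m ∸ i) (λ m∸i≡j → m≢i+j (trans (sym (ℕ.m+[n∸m]≡n i≤m)) (cong (i +ℕ_) m∸i≡j))))))

⊗-1-q^-low : ∀ f e j → j < e → (f ⊗ 1-q^ e) j ≡ f j
⊗-1-q^-low f e j j<e = begin
  (f ⊗ 1-q^ e) j          ≡⟨ at (solve 2 (λ f x → f :* (con 1ℤ :- x) := f :- x :* f) ≈-refl f (mono e)) j ⟩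
  f j + - (mono e ⊗ f) j  ≡⟨ cong (λ c → f j + - c) (mono-⊗-coeff-low e f j j<e) ⟩
  f j + 0ℤ                ≡⟨ ℤ.+-identityʳ (f j) ⟩
  f j                     ∎
  where open ≡-Reasoning

poch-suc-coeff : ∀ a b {j N} → j < N → poch a (suc b) (suc N) j ≡ poch a (suc b) N j
poch-suc-coeff a b {j} {N} j<N = ⊗-1-q^-low (poch a (suc b) N) (a +ℕ suc b *ℕ N) j
  (ℕ.<-≤-trans j<N (ℕ.≤-trans (ℕ.m≤m+n N (b *ℕ N)) (ℕ.m≤n+m (suc b *ℕ N) a)))

pochInf-coeff : ∀ a b {j} N → j < N → pochInf a (suc b) j ≡ poch a (suc b) N j
pochInf-coeff a b (suc N) j<1+N with ℕ.m<1+n⇒m<n∨m≡n j<1+N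
... | inj₁ j<N = trans (pochInf-coeff a b N j<N) (sym (poch-suc-coeff a b j<N))
... | inj₂ refl = refl

poch-head : ∀ a b n → 1-q^ a ⊗ poch (a +ℕ b) b n ≈ poch a b (suc n)
poch-head a b zero    = begin
  1-q^ a ⊗ one            ≈⟨ ⊗-identityʳ (1-q^ a) ⟩
  1-q^ a                  ≈⟨ 1-q^-cong (sym (ℕ.+-identityʳ a)) ⟩
  1-q^ (a +ℕ 0)           ≈⟨ 1-q^-cong (cong (a +ℕ_) (sym (ℕ.*-zeroʳ b))) ⟩
  1-q^ (a +ℕ b *ℕ 0)      ≈⟨ ⊗-identityˡ (1-q^ (a +ℕ b *ℕ 0)) ⟨
  one ⊗ 1-q^ (a +ℕ b *ℕ 0) ∎
  where open ≈-Reasoning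
poch-head a b (suc n) = begin
  1-q^ a ⊗ (poch (a +ℕ b) b n ⊗ 1-q^ (a +ℕ b +ℕ b *ℕ n))   ≈⟨ ⊗-assoc (1-q^ a) (poch (a +ℕ b) b n) (1-q^ (a +ℕ b +ℕ b *ℕ n)) ⟨
  (1-q^ a ⊗ poch (a +ℕ b) b n) ⊗ 1-q^ (a +ℕ b +ℕ b *ℕ n)   ≈⟨ ⊗-cong (poch-head a b n) (1-q^-cong exponent) ⟩
  poch a b (suc n) ⊗ 1-q^ (a +ℕ b *ℕ suc n)                 ∎
  where
  open ≈-Reasoning
  exponent : a +ℕ b +ℕ b *ℕ n ≡ a +ℕ b *ℕ suc n
  exponent = trans (ℕ.+-assoc a b (b *ℕ n)) (cong (a +ℕ_) (sym (ℕ.*-suc b n)))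

pochInf-head : ∀ a b → pochInf a (suc b) ≈ 1-q^ a ⊗ pochInf (a +ℕ suc b) (suc b)
pochInf-head a b = mk λ m → begin
  pochInf a (suc b) m                                ≡⟨ pochInf-coeff a b (suc (suc m)) (ℕ.m<n⇒m<1+n ℕ.≤-refl) ⟩
  poch a (suc b) (suc (suc m)) m                     ≡⟨ at (poch-head a (suc b) (suc m)) m ⟨
  (1-q^ a ⊗ poch (a +ℕ suc b) (suc b) (suc m)) m     ≡⟨ ⊗-≈[] m (≈[]-refl {1-q^ a} m) tail m ℕ.≤-refl ⟩
  (1-q^ a ⊗ pochInf (a +ℕ suc b) (suc b)) m          ∎
  where
  open ≡-Reasoning
  tail : ∀ {m} → poch (a +ℕ suc b) (suc b) (suc m) ≈[ m ] pochInf (a +ℕ suc b) (suc b)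
  tail j j≤m = sym (pochInf-coeff (a +ℕ suc b) b _ (s≤s j≤m))

poch-≈[]-one : ∀ {a} b m → m < a → ∀ N → poch a b N ≈[ m ] one
poch-≈[]-one b m m<a zero    = ≈[]-refl m
poch-≈[]-one {a} b m m<a (suc N) j j≤m =
  trans (⊗-1-q^-low (poch a b N) (a +ℕ b *ℕ N) j (ℕ.<-≤-trans (ℕ.≤-<-trans j≤m m<a) (ℕ.m≤m+n a (b *ℕ N))))
        (poch-≈[]-one b m m<a N j j≤m)

pochInf-≈[]-one : ∀ {a} b m → m < a → pochInf a b ≈[ m ] one
pochInf-≈[]-one b m m<a j j≤m = poch-≈[]-one b m m<a (suc j) j j≤m

zero-⊗ : ∀ f → zeroS ⊗ f ≈ zeroS
zero-⊗ f = solve 1 (λ f → con 0ℤ :* f := con 0ℤ) ≈-refl f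

⊗-zero : ∀ f → f ⊗ zeroS ≈ zeroS
⊗-zero f = solve 1 (λ f → f :* con 0ℤ := con 0ℤ) ≈-refl f

1-q^0-⊗ : ∀ {e} f → e ≡ 0 → 1-q^ e ⊗ f ≈ zeroS
1-q^0-⊗ f refl = ≈-trans (⊗-congʳ f 1-q^0≈0) (zero-⊗ f)

pochInf-zero : ∀ b → pochInf 0 (suc b) ≈ zeroS
pochInf-zero b = ≈-trans (pochInf-head 0 b) (1-q^0-⊗ (pochInf (suc b) (suc b)) refl)

ConstTermOne-poch : ∀ a b n → 0 < a → ConstTermOne (poch a b n)
ConstTermOne-poch a b zero    0<a = refl
ConstTermOne-poch a b (suc n) 0<a = ConstTermOne-⊗ (poch a b n) (1-q^ (a +ℕ b *ℕ n))
  (ConstTermOne-poch a b n 0<a) (ConstTermOne-1-q^ (ℕ.<-≤-trans 0<a (ℕ.m≤m+n a (b *ℕ n))))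

ConstTermOne-pochInf : ∀ a b → 0 < a → ConstTermOne (pochInf a b)
ConstTermOne-pochInf a b 0<a = ConstTermOne-poch a b 1 0<a

-- The recurrence

Recurrence : (ℕ → PS) → Set
Recurrence X = ∀ t →
  (1-q^ (1 +ℕ 2 *ℕ t) ⊗ 1-q^ (1 +ℕ 2 *ℕ t)) ⊗ X (2 +ℕ t) ≈ 1-q^ (2 *ℕ t) ⊗ X (1 +ℕ t) ⊕ mono (2 *ℕ t)

-- At t = 0 the factor 1 - q⁰ vanishes, so the recurrence pins down X 2 without any initial value.
recurrence-unique : ∀ {X Y} → Recurrence X → Recurrence Y → ∀ t → X (2 +ℕ t) ≈ Y (2 +ℕ t)
recurrence-unique {X} {Y} recX recY zero = ⊗-cancelˡ (1-q^ 1 ⊗ 1-q^ 1) refl (begin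
  (1-q^ 1 ⊗ 1-q^ 1) ⊗ X 2   ≈⟨ recX 0 ⟩
  1-q^ 0 ⊗ X 1 ⊕ one        ≈⟨ initial X ⟩
  one                       ≈⟨ initial Y ⟨
  1-q^ 0 ⊗ Y 1 ⊕ one        ≈⟨ recY 0 ⟨
  (1-q^ 1 ⊗ 1-q^ 1) ⊗ Y 2   ∎)
  where
  open ≈-Reasoning
  initial : ∀ Z → 1-q^ 0 ⊗ Z 1 ⊕ one ≈ one
  initial Z = ≈-trans (⊕-congʳ one (1-q^0-⊗ (Z 1) refl))
                      (solve 1 (λ u → con 0ℤ :+ u := u) ≈-refl one)
recurrence-unique {X} {Y} recX recY (suc t) = ⊗-cancelˡ a refl (begin
  a ⊗ X (3 +ℕ t)                           ≈⟨ recX (suc t) ⟩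
  1-q^ (2 *ℕ suc t) ⊗ X (2 +ℕ t) ⊕ c       ≈⟨ ⊕-congʳ c (⊗-congˡ (1-q^ (2 *ℕ suc t)) (recurrence-unique {X} {Y} recX recY t)) ⟩
  1-q^ (2 *ℕ suc t) ⊗ Y (2 +ℕ t) ⊕ c       ≈⟨ recY (suc t) ⟨
  a ⊗ Y (3 +ℕ t)                           ∎)
  where
  open ≈-Reasoning
  a c : PS
  a = 1-q^ (1 +ℕ 2 *ℕ suc t) ⊗ 1-q^ (1 +ℕ 2 *ℕ suc t)
  c = mono (2 *ℕ suc t)

-- The left-hand side

pochInf₂-cong : ∀ {a b} → a ≡ b → pochInf a 2 ≈ pochInf b 2
pochInf₂-cong refl = ≈-refl

lhsBody : ℕ → ℕ → PS
lhsBody k n = (pochInf (2 *ℕ n +ℕ 2) 2 ⊗ pochInf (2 *ℕ n +ℕ 2 *ℕ k) 2)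
              ⊘ (pochInf (2 *ℕ n +ℕ 1) 2 ⊗ pochInf (2 *ℕ n +ℕ 1) 2)

lhsTelescoper : ℕ → ℕ → PS
lhsTelescoper k n = (pochInf (2 *ℕ n) 2 ⊗ pochInf (2 *ℕ n +ℕ 2 *ℕ k) 2)
                    ⊘ (pochInf (2 *ℕ n +ℕ 1) 2 ⊗ pochInf (2 *ℕ n +ℕ 1) 2)

lhsTerm-low : ∀ k n j → j < 2 *ℕ n → lhsTerm k n j ≡ 0ℤ
lhsTerm-low k n j j<2n =
  trans (at (⊗-comm (lhsBody k n) (mono (2 *ℕ n))) j) (mono-⊗-coeff-low (2 *ℕ n) (lhsBody k n) j j<2n)

lhs-≈[]-sumPS : ∀ k m → lhs k ≈[ m ] sumPS (suc m) (lhsTerm k)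
lhs-≈[]-sumPS k m j j≤m = sym (Σ<-extend (suc m) (λ n → lhsTerm k n j) (s≤s j≤m)
  (λ n j<n → lhsTerm-low k n j (ℕ.<-≤-trans j<n (ℕ.m≤m+n n (n +ℕ 0)))))

lhsTelescoper-zero : ∀ k → lhsTelescoper k 0 ≈ zeroS
lhsTelescoper-zero k = ≈-trans (⊗-congʳ (inv (pochInf 1 2 ⊗ pochInf 1 2))
                                        (≈-trans (⊗-congʳ (pochInf (2 *ℕ k) 2) (pochInf-zero 1)) (zero-⊗ (pochInf (2 *ℕ k) 2))))
                               (zero-⊗ (inv (pochInf 1 2 ⊗ pochInf 1 2)))

lhsTelescoper-≈[]-one : ∀ k m → lhsTelescoper k (suc m) ≈[ m ] one
lhsTelescoper-≈[]-one k m = begin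
  lhsTelescoper k (suc m)                 ≈⟨ ⊗-≈[] m (⊗-≈[] m (high ℕ.≤-refl) (high (ℕ.m≤m+n _ (2 *ℕ k))))
                                                     (inv-≈[] m (⊗-≈[] m (high (ℕ.m≤m+n _ 1)) (high (ℕ.m≤m+n _ 1)))) ⟩
  (one ⊗ one) ⊗ inv (one ⊗ one)           ≈⟨ ≈⇒≈[] m (⊗-cong (⊗-identityˡ one) (≈-trans (inv-cong (⊗-identityˡ one)) inv-one)) ⟩
  one ⊗ one                               ≈⟨ ≈⇒≈[] m (⊗-identityˡ one) ⟩
  one                                     ∎
  where
  open ≈[]-Reasoning m
  high : ∀ {a} → 2 *ℕ suc m ≤ a → pochInf a 2 ≈[ m ] one
  high 2m+2≤a = pochInf-≈[]-one 2 m (ℕ.<-≤-trans (ℕ.<-≤-trans (ℕ.n<1+n m) (ℕ.m≤m+n (suc m) _)) 2m+2≤a)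

lhsTelescoper-body : ∀ k n → lhsTelescoper k n ≈ 1-q^ (2 *ℕ n) ⊗ lhsBody k n
lhsTelescoper-body k n = begin
  (pochInf (2 *ℕ n) 2 ⊗ Y) ⊗ W                           ≈⟨ ⊗-congʳ W (⊗-congʳ Y (pochInf-head (2 *ℕ n) 1)) ⟩
  ((1-q^ (2 *ℕ n) ⊗ pochInf (2 *ℕ n +ℕ 2) 2) ⊗ Y) ⊗ W    ≈⟨ solve 4 (λ u X Y W → ((u :* X) :* Y) :* W := u :* ((X :* Y) :* W)) ≈-refl
                                                             (1-q^ (2 *ℕ n)) (pochInf (2 *ℕ n +ℕ 2) 2) Y W ⟩
  1-q^ (2 *ℕ n) ⊗ lhsBody k n                            ∎
  where
  open ≈-Reasoning
  Y W : PS
  Y = pochInf (2 *ℕ n +ℕ 2 *ℕ k) 2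
  W = inv (pochInf (2 *ℕ n +ℕ 1) 2 ⊗ pochInf (2 *ℕ n +ℕ 1) 2)

lhsBody-suc : ∀ k n → lhsBody k n ≈ 1-q^ (2 *ℕ n +ℕ 2 *ℕ k) ⊗ lhsBody (suc k) n
lhsBody-suc k n = begin
  (X ⊗ pochInf (2 *ℕ n +ℕ 2 *ℕ k) 2) ⊗ W                     ≈⟨ ⊗-congʳ W (⊗-congˡ X (pochInf-head (2 *ℕ n +ℕ 2 *ℕ k) 1)) ⟩
  (X ⊗ (1-q^ (2 *ℕ n +ℕ 2 *ℕ k) ⊗ pochInf (2 *ℕ n +ℕ 2 *ℕ k +ℕ 2) 2)) ⊗ W
                                                              ≈⟨ ⊗-congʳ W (⊗-congˡ X (⊗-congˡ (1-q^ (2 *ℕ n +ℕ 2 *ℕ k)) (pochInf₂-cong (exponent n k)))) ⟩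
  (X ⊗ (1-q^ (2 *ℕ n +ℕ 2 *ℕ k) ⊗ Y′)) ⊗ W                   ≈⟨ solve 4 (λ u X Y W → (X :* (u :* Y)) :* W := u :* ((X :* Y) :* W)) ≈-refl
                                                                 (1-q^ (2 *ℕ n +ℕ 2 *ℕ k)) X Y′ W ⟩
  1-q^ (2 *ℕ n +ℕ 2 *ℕ k) ⊗ lhsBody (suc k) n                ∎
  where
  open ≈-Reasoning
  X Y′ W : PS
  X = pochInf (2 *ℕ n +ℕ 2) 2
  Y′ = pochInf (2 *ℕ n +ℕ 2 *ℕ suc k) 2
  W = inv (pochInf (2 *ℕ n +ℕ 1) 2 ⊗ pochInf (2 *ℕ n +ℕ 1) 2)
  exponent : ∀ n k → 2 *ℕ n +ℕ 2 *ℕ k +ℕ 2 ≡ 2 *ℕ n +ℕ 2 *ℕ suc k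
  exponent = ℕ-Solver.solve-∀

lhsTelescoper-suc : ∀ k n → lhsTelescoper k (suc n) ≈ (1-q^ (2 *ℕ n +ℕ 1) ⊗ 1-q^ (2 *ℕ n +ℕ 1)) ⊗ lhsBody (suc k) n
lhsTelescoper-suc k n = begin
  (pochInf (2 *ℕ suc n) 2 ⊗ pochInf (2 *ℕ suc n +ℕ 2 *ℕ k) 2) ⊗ inv (pochInf (2 *ℕ suc n +ℕ 1) 2 ⊗ pochInf (2 *ℕ suc n +ℕ 1) 2)
    ≈⟨ ⊗-cong (⊗-cong (pochInf₂-cong (e₁ n)) (pochInf₂-cong (e₂ n k))) (inv-cong (⊗-cong (pochInf₂-cong (e₃ n)) (pochInf₂-cong (e₃ n)))) ⟩
  (X ⊗ Y′) ⊗ inv (Z′ ⊗ Z′)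
    ≈⟨ ⊗-congˡ (X ⊗ Y′) (inv-square-factor f Z Z′ (ConstTermOne-1-q^ 0<2n+1) (ConstTermOne-pochInf (2 *ℕ n +ℕ 1 +ℕ 2) 2 (ℕ.<-≤-trans 0<2n+1 (ℕ.m≤m+n _ 2)))
                                                  (pochInf-head (2 *ℕ n +ℕ 1) 1)) ⟩
  (X ⊗ Y′) ⊗ ((f ⊗ f) ⊗ inv (Z ⊗ Z))
    ≈⟨ solve 3 (λ A u W → A :* (u :* W) := u :* (A :* W)) ≈-refl (X ⊗ Y′) (f ⊗ f) (inv (Z ⊗ Z)) ⟩
  (f ⊗ f) ⊗ lhsBody (suc k) n ∎
  where
  open ≈-Reasoning
  X Y′ Z Z′ f : PS
  X = pochInf (2 *ℕ n +ℕ 2) 2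
  Y′ = pochInf (2 *ℕ n +ℕ 2 *ℕ suc k) 2
  Z = pochInf (2 *ℕ n +ℕ 1) 2
  Z′ = pochInf (2 *ℕ n +ℕ 1 +ℕ 2) 2
  f = 1-q^ (2 *ℕ n +ℕ 1)
  0<2n+1 : 0 < 2 *ℕ n +ℕ 1
  0<2n+1 = ℕ.m≤n+m 1 (2 *ℕ n)
  e₁ : ∀ n → 2 *ℕ suc n ≡ 2 *ℕ n +ℕ 2
  e₁ = ℕ-Solver.solve-∀
  e₂ : ∀ n k → 2 *ℕ suc n +ℕ 2 *ℕ k ≡ 2 *ℕ n +ℕ 2 *ℕ suc k
  e₂ = ℕ-Solver.solve-∀
  e₃ : ∀ n → 2 *ℕ suc n +ℕ 1 ≡ 2 *ℕ n +ℕ 1 +ℕ 2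
  e₃ = ℕ-Solver.solve-∀

-- With G = lhsBody (2 + t) n, x = q^{2n}, c = q^{2t}, the termwise recurrence is this polynomial identity times G.
lhsTerm-identity : ∀ G x q c →
  ((one ⊖ q ⊗ c) ⊗ (one ⊖ q ⊗ c)) ⊗ (G ⊗ x)
    ≈ (one ⊖ c) ⊗ (((one ⊖ x ⊗ c ⊗ q ⊗ q) ⊗ G) ⊗ x)
      ⊕ (c ⊗ (((one ⊖ x ⊗ q) ⊗ (one ⊖ x ⊗ q)) ⊗ G) ⊖ c ⊗ ((one ⊖ x) ⊗ ((one ⊖ x ⊗ c ⊗ q ⊗ q) ⊗ G)))
lhsTerm-identity = solve 4 (λ G x q c →
  ((con 1ℤ :- q :* c) :* (con 1ℤ :- q :* c)) :* (G :* x)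
    := (con 1ℤ :- c) :* (((con 1ℤ :- x :* c :* q :* q) :* G) :* x)
       :+ (c :* (((con 1ℤ :- x :* q) :* (con 1ℤ :- x :* q)) :* G)
           :- c :* ((con 1ℤ :- x) :* ((con 1ℤ :- x :* c :* q :* q) :* G)))) ≈-refl

lhsTerm-recurrence : ∀ t n →
  (1-q^ (1 +ℕ 2 *ℕ t) ⊗ 1-q^ (1 +ℕ 2 *ℕ t)) ⊗ lhsTerm (2 +ℕ t) n
    ≈ 1-q^ (2 *ℕ t) ⊗ lhsTerm (1 +ℕ t) n
      ⊕ (mono (2 *ℕ t) ⊗ lhsTelescoper (1 +ℕ t) (suc n) ⊖ mono (2 *ℕ t) ⊗ lhsTelescoper (1 +ℕ t) n)
lhsTerm-recurrence t n = begin
  (1-q^ (1 +ℕ 2 *ℕ t) ⊗ 1-q^ (1 +ℕ 2 *ℕ t)) ⊗ (G ⊗ x)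
    ≈⟨ ⊗-congʳ (G ⊗ x) (⊗-cong qc qc) ⟩
  ((one ⊖ q ⊗ c) ⊗ (one ⊖ q ⊗ c)) ⊗ (G ⊗ x)
    ≈⟨ lhsTerm-identity G x q c ⟩
  (one ⊖ c) ⊗ (((one ⊖ x ⊗ c ⊗ q ⊗ q) ⊗ G) ⊗ x)
    ⊕ (c ⊗ (((one ⊖ x ⊗ q) ⊗ (one ⊖ x ⊗ q)) ⊗ G) ⊖ c ⊗ ((one ⊖ x) ⊗ ((one ⊖ x ⊗ c ⊗ q ⊗ q) ⊗ G)))
    ≈⟨ ⊕-cong (⊗-congˡ (one ⊖ c) (⊗-congʳ x (≈-sym body)))
              (⊕-cong (⊗-congˡ c (≈-sym telescoper-suc)) (neg-cong (⊗-congˡ c (≈-sym telescoper)))) ⟩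
  1-q^ (2 *ℕ t) ⊗ lhsTerm (1 +ℕ t) n
    ⊕ (c ⊗ lhsTelescoper (1 +ℕ t) (suc n) ⊖ c ⊗ lhsTelescoper (1 +ℕ t) n) ∎
  where
  open ≈-Reasoning
  G x q c : PS
  G = lhsBody (2 +ℕ t) n
  x = mono (2 *ℕ n)
  q = mono 1
  c = mono (2 *ℕ t)
  qc : 1-q^ (1 +ℕ 2 *ℕ t) ≈ one ⊖ q ⊗ c
  qc = 1-q^-≈ (mono-+ 1 (2 *ℕ t))
  exponent : ∀ n t → 2 *ℕ n +ℕ 2 *ℕ (1 +ℕ t) ≡ 2 *ℕ n +ℕ 2 *ℕ t +ℕ 1 +ℕ 1
  exponent = ℕ-Solver.solve-∀
  body : lhsBody (1 +ℕ t) n ≈ (one ⊖ x ⊗ c ⊗ q ⊗ q) ⊗ G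
  body = ≈-trans (lhsBody-suc (1 +ℕ t) n) (⊗-congʳ G (1-q^-≈ (≈-trans (mono-cong (exponent n t))
           (≈-trans (mono-+ _ 1) (⊗-congʳ q (≈-trans (mono-+ _ 1) (⊗-congʳ q (mono-+ (2 *ℕ n) (2 *ℕ t)))))))))
  telescoper-suc : lhsTelescoper (1 +ℕ t) (suc n) ≈ ((one ⊖ x ⊗ q) ⊗ (one ⊖ x ⊗ q)) ⊗ G
  telescoper-suc = ≈-trans (lhsTelescoper-suc (1 +ℕ t) n)
                           (⊗-congʳ G (⊗-cong (1-q^-≈ (mono-+ (2 *ℕ n) 1)) (1-q^-≈ (mono-+ (2 *ℕ n) 1))))
  telescoper : lhsTelescoper (1 +ℕ t) n ≈ (one ⊖ x) ⊗ ((one ⊖ x ⊗ c ⊗ q ⊗ q) ⊗ G)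
  telescoper = ≈-trans (lhsTelescoper-body (1 +ℕ t) n) (⊗-congˡ (one ⊖ x) body)

lhs-recurrence : Recurrence lhs
lhs-recurrence t = ≈[]⇒≈ up-to
  where
  a b c : PS
  a = 1-q^ (1 +ℕ 2 *ℕ t) ⊗ 1-q^ (1 +ℕ 2 *ℕ t)
  b = 1-q^ (2 *ℕ t)
  c = mono (2 *ℕ t)
  up-to : ∀ m → a ⊗ lhs (2 +ℕ t) ≈[ m ] b ⊗ lhs (1 +ℕ t) ⊕ c
  up-to m = begin
    a ⊗ lhs (2 +ℕ t)
      ≈⟨ ⊗-≈[] m (≈[]-refl {a} m) (lhs-≈[]-sumPS (2 +ℕ t) m) ⟩
    a ⊗ sumPS (suc m) (lhsTerm (2 +ℕ t))
      ≈⟨ ≈⇒≈[] m (⊗-sumPS-telescope (suc m) a b (lhsTerm (1 +ℕ t)) (lhsTerm (2 +ℕ t)) (λ n → c ⊗ lhsTelescoper (1 +ℕ t) n)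
                                    (λ n _ → lhsTerm-recurrence t n)) ⟩
    b ⊗ sumPS (suc m) (lhsTerm (1 +ℕ t)) ⊕ (c ⊗ lhsTelescoper (1 +ℕ t) (suc m) ⊖ c ⊗ lhsTelescoper (1 +ℕ t) 0)
      ≈⟨ ⊕-≈[] m (⊗-≈[] m (≈[]-refl {b} m) (≈[]-sym m (lhs-≈[]-sumPS (1 +ℕ t) m)))
                 (⊖-≈[] m (⊗-≈[] m (≈[]-refl {c} m) (lhsTelescoper-≈[]-one (1 +ℕ t) m))
                          (≈⇒≈[] m (⊗-congˡ c (lhsTelescoper-zero (1 +ℕ t))))) ⟩
    b ⊗ lhs (1 +ℕ t) ⊕ (c ⊗ one ⊖ c ⊗ zeroS)
      ≈⟨ ≈⇒≈[] m (⊕-congˡ (b ⊗ lhs (1 +ℕ t)) (solve 1 (λ c → c :* con 1ℤ :- c :* con 0ℤ := c) ≈-refl c)) ⟩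
    b ⊗ lhs (1 +ℕ t) ⊕ c ∎
    where open ≈[]-Reasoning m

-- The right-hand side

evenPoch oddPoch : ℕ → PS
evenPoch = poch 2 2
oddPoch  = poch 1 2

ConstTermOne-evenPoch : ∀ n → ConstTermOne (evenPoch n)
ConstTermOne-evenPoch n = ConstTermOne-poch 2 2 n (s≤s z≤n)

ConstTermOne-oddPoch : ∀ n → ConstTermOne (oddPoch n)
ConstTermOne-oddPoch n = ConstTermOne-poch 1 2 n (s≤s z≤n)

inv-evenPoch-suc : ∀ i → inv (evenPoch i) ≈ 1-q^ (2 *ℕ suc i) ⊗ inv (evenPoch (suc i))
inv-evenPoch-suc i = ≈-trans (inv-extend (evenPoch i) (1-q^ (2 +ℕ 2 *ℕ i)) (ConstTermOne-evenPoch i) refl)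
                             (⊗-congʳ (inv (evenPoch (suc i))) (1-q^-cong (exponent i)))
  where
  exponent : ∀ i → 2 +ℕ 2 *ℕ i ≡ 2 *ℕ suc i
  exponent = ℕ-Solver.solve-∀

qFalling : ℕ → ℕ → PS
qFalling M j = qbin2 M j ⊗ evenPoch j

qFalling-≤ : ∀ {M j} → j ≤ M → qFalling M j ≈ evenPoch M ⊗ inv (evenPoch (M ∸ j))
qFalling-≤ {M} {j} j≤M with j ≤ᵇ M in eq
... | false = ⊥-elim (subst T eq (ℕ.≤⇒≤ᵇ j≤M))
... | true = begin
  (evenPoch M ⊗ inv (evenPoch j ⊗ evenPoch (M ∸ j))) ⊗ evenPoch j
    ≈⟨ ⊗-congʳ (evenPoch j) (⊗-congˡ (evenPoch M) (inv-⊗ (evenPoch j) (evenPoch (M ∸ j)) (ConstTermOne-evenPoch j) (ConstTermOne-evenPoch (M ∸ j)))) ⟩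
  (evenPoch M ⊗ (inv (evenPoch j) ⊗ inv (evenPoch (M ∸ j)))) ⊗ evenPoch j
    ≈⟨ solve 4 (λ a b c d → (a :* (b :* c)) :* d := (a :* c) :* (b :* d)) ≈-refl
         (evenPoch M) (inv (evenPoch j)) (inv (evenPoch (M ∸ j))) (evenPoch j) ⟩
  (evenPoch M ⊗ inv (evenPoch (M ∸ j))) ⊗ (inv (evenPoch j) ⊗ evenPoch j)
    ≈⟨ ⊗-congˡ (evenPoch M ⊗ inv (evenPoch (M ∸ j))) (⊗-inverseˡ (evenPoch j) (ConstTermOne-evenPoch j)) ⟩
  (evenPoch M ⊗ inv (evenPoch (M ∸ j))) ⊗ one
    ≈⟨ ⊗-identityʳ (evenPoch M ⊗ inv (evenPoch (M ∸ j))) ⟩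
  evenPoch M ⊗ inv (evenPoch (M ∸ j)) ∎
  where open ≈-Reasoning

qFalling-> : ∀ {M j} → M < j → qFalling M j ≈ zeroS
qFalling-> {M} {j} M<j with j ≤ᵇ M in eq
... | true  = ⊥-elim (ℕ.<⇒≱ M<j (ℕ.≤ᵇ⇒≤ j M (subst T (sym eq) tt)))
... | false = zero-⊗ (evenPoch j)

qFalling-suc-suc : ∀ N j → 1-q^ (2 *ℕ suc N) ⊗ qFalling N j ≈ qFalling (suc N) (suc j)
qFalling-suc-suc N j with j ℕ.≤? N
... | yes j≤N = begin
  1-q^ (2 *ℕ suc N) ⊗ qFalling N j                          ≈⟨ ⊗-congˡ (1-q^ (2 *ℕ suc N)) (qFalling-≤ j≤N) ⟩
  1-q^ (2 *ℕ suc N) ⊗ (evenPoch N ⊗ inv (evenPoch (N ∸ j)))  ≈⟨ solve 3 (λ u p i → u :* (p :* i) := (p :* u) :* i) ≈-refl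
                                                                  (1-q^ (2 *ℕ suc N)) (evenPoch N) (inv (evenPoch (N ∸ j))) ⟩
  (evenPoch N ⊗ 1-q^ (2 *ℕ suc N)) ⊗ inv (evenPoch (N ∸ j))  ≈⟨ ⊗-congʳ (inv (evenPoch (N ∸ j))) (⊗-congˡ (evenPoch N) (1-q^-cong (exponent N))) ⟩
  evenPoch (suc N) ⊗ inv (evenPoch (suc N ∸ suc j))          ≈⟨ qFalling-≤ (s≤s j≤N) ⟨
  qFalling (suc N) (suc j)                                   ∎
  where
  open ≈-Reasoning
  exponent : ∀ N → 2 *ℕ suc N ≡ 2 +ℕ 2 *ℕ N
  exponent = ℕ-Solver.solve-∀
... | no j≰N = begin
  1-q^ (2 *ℕ suc N) ⊗ qFalling N j   ≈⟨ ⊗-congˡ (1-q^ (2 *ℕ suc N)) (qFalling-> (ℕ.≰⇒> j≰N)) ⟩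
  1-q^ (2 *ℕ suc N) ⊗ zeroS          ≈⟨ ⊗-zero (1-q^ (2 *ℕ suc N)) ⟩
  zeroS                              ≈⟨ qFalling-> (s≤s (ℕ.≰⇒> j≰N)) ⟨
  qFalling (suc N) (suc j)           ∎
  where open ≈-Reasoning

qFalling-sucʳ : ∀ M j → qFalling M (suc j) ≈ 1-q^ (2 *ℕ (M ∸ j)) ⊗ qFalling M j
qFalling-sucʳ M j with suc j ℕ.≤? M
... | yes j<M = begin
  qFalling M (suc j)
    ≈⟨ qFalling-≤ j<M ⟩
  evenPoch M ⊗ inv (evenPoch (M ∸ suc j))
    ≈⟨ ⊗-congˡ (evenPoch M) (inv-evenPoch-suc (M ∸ suc j)) ⟩
  evenPoch M ⊗ (1-q^ (2 *ℕ suc (M ∸ suc j)) ⊗ inv (evenPoch (suc (M ∸ suc j))))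
    ≈⟨ ≡⇒≈ (cong (λ d → evenPoch M ⊗ (1-q^ (2 *ℕ d) ⊗ inv (evenPoch d))) (sym (ℕ.+-∸-assoc 1 j<M))) ⟩
  evenPoch M ⊗ (1-q^ (2 *ℕ (M ∸ j)) ⊗ inv (evenPoch (M ∸ j)))
    ≈⟨ solve 3 (λ p u i → p :* (u :* i) := u :* (p :* i)) ≈-refl (evenPoch M) (1-q^ (2 *ℕ (M ∸ j))) (inv (evenPoch (M ∸ j))) ⟩
  1-q^ (2 *ℕ (M ∸ j)) ⊗ (evenPoch M ⊗ inv (evenPoch (M ∸ j)))
    ≈⟨ ⊗-congˡ (1-q^ (2 *ℕ (M ∸ j))) (qFalling-≤ (ℕ.<⇒≤ j<M)) ⟨
  1-q^ (2 *ℕ (M ∸ j)) ⊗ qFalling M j ∎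
  where open ≈-Reasoning
... | no j≮M = begin
  qFalling M (suc j)                   ≈⟨ qFalling-> (s≤s M≤j) ⟩
  zeroS                                ≈⟨ 1-q^0-⊗ (qFalling M j) (cong (2 *ℕ_) (ℕ.m≤n⇒m∸n≡0 M≤j)) ⟨
  1-q^ (2 *ℕ (M ∸ j)) ⊗ qFalling M j   ∎
  where
  open ≈-Reasoning
  M≤j : M ≤ j
  M≤j = ℕ.≤-pred (ℕ.≰⇒> j≮M)

qFalling-pred : ∀ M j → 1-q^ (2 *ℕ M) ⊗ qFalling (M ∸ 1) j ≈ 1-q^ (2 *ℕ (M ∸ j)) ⊗ qFalling M j
qFalling-pred zero    j = ≈-trans (1-q^0-⊗ (qFalling 0 j) refl)
                                  (≈-sym (1-q^0-⊗ (qFalling 0 j) (cong (2 *ℕ_) (ℕ.0∸n≡0 j))))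
qFalling-pred (suc N) j = ≈-trans (qFalling-suc-suc N j) (qFalling-sucʳ (suc N) j)

rhsBody : ℕ → ℕ → PS
rhsBody M j = (qFalling M j ⊗ mono (2 *ℕ j *ℕ j)) ⊘ (oddPoch (suc j) ⊗ oddPoch (suc j))

rhsTelescoper : ℕ → ℕ → PS
rhsTelescoper M j = (qFalling M j ⊗ mono (2 *ℕ j *ℕ j)) ⊘ (oddPoch j ⊗ oddPoch j)

rhsTerm-body : ∀ k j → rhsTerm k j ≈ mono (2 *ℕ j) ⊗ rhsBody (k ∸ 2) j
rhsTerm-body k j = begin
  (F ⊗ mono (2 *ℕ j *ℕ j +ℕ 2 *ℕ j)) ⊗ W        ≈⟨ ⊗-congʳ W (⊗-congˡ F (mono-+ (2 *ℕ j *ℕ j) (2 *ℕ j))) ⟩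
  (F ⊗ (mono (2 *ℕ j *ℕ j) ⊗ mono (2 *ℕ j))) ⊗ W  ≈⟨ solve 4 (λ F Q y W → (F :* (Q :* y)) :* W := y :* ((F :* Q) :* W)) ≈-refl
                                                       F (mono (2 *ℕ j *ℕ j)) (mono (2 *ℕ j)) W ⟩
  mono (2 *ℕ j) ⊗ rhsBody (k ∸ 2) j               ∎
  where
  open ≈-Reasoning
  F W : PS
  F = qFalling (k ∸ 2) j
  W = inv (oddPoch (suc j) ⊗ oddPoch (suc j))

rhsBody-pred : ∀ M j → 1-q^ (2 *ℕ M) ⊗ rhsBody (M ∸ 1) j ≈ 1-q^ (2 *ℕ (M ∸ j)) ⊗ rhsBody M j
rhsBody-pred M j = begin
  1-q^ (2 *ℕ M) ⊗ ((qFalling (M ∸ 1) j ⊗ Q) ⊗ W)          ≈⟨ reassociate (1-q^ (2 *ℕ M)) (qFalling (M ∸ 1) j) ⟩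
  ((1-q^ (2 *ℕ M) ⊗ qFalling (M ∸ 1) j) ⊗ Q) ⊗ W          ≈⟨ ⊗-congʳ W (⊗-congʳ Q (qFalling-pred M j)) ⟩
  ((1-q^ (2 *ℕ (M ∸ j)) ⊗ qFalling M j) ⊗ Q) ⊗ W          ≈⟨ reassociate (1-q^ (2 *ℕ (M ∸ j))) (qFalling M j) ⟨
  1-q^ (2 *ℕ (M ∸ j)) ⊗ ((qFalling M j ⊗ Q) ⊗ W)          ∎
  where
  open ≈-Reasoning
  Q W : PS
  Q = mono (2 *ℕ j *ℕ j)
  W = inv (oddPoch (suc j) ⊗ oddPoch (suc j))
  reassociate : ∀ u F → u ⊗ ((F ⊗ Q) ⊗ W) ≈ ((u ⊗ F) ⊗ Q) ⊗ W
  reassociate u F = solve 4 (λ u F Q W → u :* ((F :* Q) :* W) := ((u :* F) :* Q) :* W) ≈-refl u F Q W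

rhsTelescoper-body : ∀ M j → rhsTelescoper M j ≈ (1-q^ (1 +ℕ 2 *ℕ j) ⊗ 1-q^ (1 +ℕ 2 *ℕ j)) ⊗ rhsBody M j
rhsTelescoper-body M j = begin
  A ⊗ inv (oddPoch j ⊗ oddPoch j)                                      ≈⟨ ⊗-congˡ A (inv-square-factor f (oddPoch (suc j)) (oddPoch j) refl
                                                                             (ConstTermOne-oddPoch j) (⊗-comm (oddPoch j) f)) ⟩
  A ⊗ ((f ⊗ f) ⊗ inv (oddPoch (suc j) ⊗ oddPoch (suc j)))              ≈⟨ solve 3 (λ A u W → A :* (u :* W) := u :* (A :* W)) ≈-refl
                                                                             A (f ⊗ f) (inv (oddPoch (suc j) ⊗ oddPoch (suc j))) ⟩
  (f ⊗ f) ⊗ rhsBody M j                                                ∎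
  where
  open ≈-Reasoning
  A f : PS
  A = qFalling M j ⊗ mono (2 *ℕ j *ℕ j)
  f = 1-q^ (1 +ℕ 2 *ℕ j)

rhsTelescoper-suc : ∀ M j → rhsTelescoper M (suc j) ≈ 1-q^ (2 *ℕ (M ∸ j)) ⊗ (mono (4 *ℕ j +ℕ 2) ⊗ rhsBody M j)
rhsTelescoper-suc M j = begin
  (qFalling M (suc j) ⊗ mono (2 *ℕ suc j *ℕ suc j)) ⊗ W
    ≈⟨ ⊗-congʳ W (⊗-cong (qFalling-sucʳ M j) (≈-trans (mono-cong (exponent j)) (mono-+ (2 *ℕ j *ℕ j) (4 *ℕ j +ℕ 2)))) ⟩
  (((1-q^ (2 *ℕ (M ∸ j))) ⊗ qFalling M j) ⊗ (mono (2 *ℕ j *ℕ j) ⊗ mono (4 *ℕ j +ℕ 2))) ⊗ W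
    ≈⟨ solve 5 (λ u F Q r W → ((u :* F) :* (Q :* r)) :* W := u :* (r :* ((F :* Q) :* W))) ≈-refl
         (1-q^ (2 *ℕ (M ∸ j))) (qFalling M j) (mono (2 *ℕ j *ℕ j)) (mono (4 *ℕ j +ℕ 2)) W ⟩
  1-q^ (2 *ℕ (M ∸ j)) ⊗ (mono (4 *ℕ j +ℕ 2) ⊗ rhsBody M j) ∎
  where
  open ≈-Reasoning
  W : PS
  W = inv (oddPoch (suc j) ⊗ oddPoch (suc j))
  exponent : ∀ j → 2 *ℕ suc j *ℕ suc j ≡ 2 *ℕ j *ℕ j +ℕ (4 *ℕ j +ℕ 2)
  exponent = ℕ-Solver.solve-∀

rhsTelescoper-zero : ∀ M → rhsTelescoper M 0 ≈ one
rhsTelescoper-zero M = begin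
  (qFalling M 0 ⊗ one) ⊗ inv (one ⊗ one)   ≈⟨ ⊗-cong (⊗-identityʳ (qFalling M 0)) (≈-trans (inv-cong (⊗-identityˡ one)) inv-one) ⟩
  qFalling M 0 ⊗ one                       ≈⟨ ⊗-identityʳ (qFalling M 0) ⟩
  qFalling M 0                             ≈⟨ qFalling-≤ {M} z≤n ⟩
  evenPoch M ⊗ inv (evenPoch M)            ≈⟨ ⊗-inverseʳ (evenPoch M) (ConstTermOne-evenPoch M) ⟩
  one                                      ∎
  where open ≈-Reasoning

qFalling-⊗-vanish : ∀ {M j} → M < j → ∀ f g → (qFalling M j ⊗ f) ⊗ g ≈ zeroS
qFalling-⊗-vanish M<j f g = ≈-trans (⊗-congʳ g (≈-trans (⊗-congʳ f (qFalling-> M<j)) (zero-⊗ f))) (zero-⊗ g)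

rhsTelescoper-vanish : ∀ M → rhsTelescoper M (suc M) ≈ zeroS
rhsTelescoper-vanish M = qFalling-⊗-vanish {M} ℕ.≤-refl (mono (2 *ℕ suc M *ℕ suc M)) (inv (oddPoch (suc M) ⊗ oddPoch (suc M)))

-- rhs 1 is computed with the truncated 1 ∸ 2 = 0; it only occurs multiplied by 1 - q⁰.
rhs-≈-sumPS : ∀ t → rhs (suc t) ≈ sumPS (suc t) (rhsTerm (suc t))
rhs-≈-sumPS zero    = ≈-refl
rhs-≈-sumPS (suc N) = ≈-sym (≈-trans (⊕-congˡ (rhs (2 +ℕ N)) last-term)
                                    (solve 1 (λ f → f :+ con 0ℤ := f) ≈-refl (rhs (2 +ℕ N))))
  where
  last-term : rhsTerm (2 +ℕ N) (suc N) ≈ zeroS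
  last-term = qFalling-⊗-vanish {N} ℕ.≤-refl (mono (2 *ℕ suc N *ℕ suc N +ℕ 2 *ℕ suc N)) (inv (oddPoch (2 +ℕ N) ⊗ oddPoch (2 +ℕ N)))

-- With K = rhsBody M j, y = q^{2j}, y′ = q^{2(M-j)} (so q^{2M} = y′ y), the termwise recurrence is this identity times K.
rhsTerm-identity : ∀ K q y′ y →
  ((one ⊖ q ⊗ (y′ ⊗ y)) ⊗ (one ⊖ q ⊗ (y′ ⊗ y))) ⊗ (y ⊗ K)
    ≈ y ⊗ ((one ⊖ y′) ⊗ K)
      ⊕ ((y′ ⊗ y) ⊗ (one ⊖ (one ⊖ y′) ⊗ ((y ⊗ y ⊗ q ⊗ q) ⊗ K))
         ⊖ (y′ ⊗ y) ⊗ (one ⊖ ((one ⊖ q ⊗ y) ⊗ (one ⊖ q ⊗ y)) ⊗ K))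
rhsTerm-identity = solve 4 (λ K q y′ y →
  ((con 1ℤ :- q :* (y′ :* y)) :* (con 1ℤ :- q :* (y′ :* y))) :* (y :* K)
    := y :* ((con 1ℤ :- y′) :* K)
       :+ ((y′ :* y) :* (con 1ℤ :- (con 1ℤ :- y′) :* ((y :* y :* q :* q) :* K))
           :- (y′ :* y) :* (con 1ℤ :- ((con 1ℤ :- q :* y) :* (con 1ℤ :- q :* y)) :* K))) ≈-refl

-- Using 1 - rhsTelescoper makes the telescoping terms run from 0 at j = 0 to q^{2M} at j = M + 1, as on the left.
rhsTerm-recurrence : ∀ M j → j ≤ M →
  (1-q^ (1 +ℕ 2 *ℕ M) ⊗ 1-q^ (1 +ℕ 2 *ℕ M)) ⊗ rhsTerm (2 +ℕ M) j
    ≈ 1-q^ (2 *ℕ M) ⊗ rhsTerm (1 +ℕ M) j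
      ⊕ (mono (2 *ℕ M) ⊗ (one ⊖ rhsTelescoper M (suc j)) ⊖ mono (2 *ℕ M) ⊗ (one ⊖ rhsTelescoper M j))
rhsTerm-recurrence M j j≤M = begin
  (1-q^ (1 +ℕ 2 *ℕ M) ⊗ 1-q^ (1 +ℕ 2 *ℕ M)) ⊗ rhsTerm (2 +ℕ M) j
    ≈⟨ ⊗-cong (⊗-cong qc qc) (rhsTerm-body (2 +ℕ M) j) ⟩
  ((one ⊖ q ⊗ (y′ ⊗ y)) ⊗ (one ⊖ q ⊗ (y′ ⊗ y))) ⊗ (y ⊗ K)
    ≈⟨ rhsTerm-identity K q y′ y ⟩
  y ⊗ ((one ⊖ y′) ⊗ K)
    ⊕ ((y′ ⊗ y) ⊗ (one ⊖ (one ⊖ y′) ⊗ ((y ⊗ y ⊗ q ⊗ q) ⊗ K))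
       ⊖ (y′ ⊗ y) ⊗ (one ⊖ ((one ⊖ q ⊗ y) ⊗ (one ⊖ q ⊗ y)) ⊗ K))
    ≈⟨ ⊕-cong previous (⊕-cong (⊗-cong (≈-sym c≈y′y) (⊕-congˡ one (neg-cong (≈-sym telescoper-suc))))
                               (neg-cong (⊗-cong (≈-sym c≈y′y) (⊕-congˡ one (neg-cong (≈-sym telescoper)))))) ⟩
  1-q^ (2 *ℕ M) ⊗ rhsTerm (1 +ℕ M) j
    ⊕ (c ⊗ (one ⊖ rhsTelescoper M (suc j)) ⊖ c ⊗ (one ⊖ rhsTelescoper M j)) ∎
  where
  open ≈-Reasoning
  K y y′ q c : PS
  K = rhsBody M j
  y = mono (2 *ℕ j)
  y′ = mono (2 *ℕ (M ∸ j))
  q = mono 1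
  c = mono (2 *ℕ M)
  c≈y′y : c ≈ y′ ⊗ y
  c≈y′y = ≈-trans (mono-cong (trans (cong (2 *ℕ_) (sym (ℕ.m∸n+n≡m j≤M))) (ℕ.*-distribˡ-+ 2 (M ∸ j) j)))
                  (mono-+ (2 *ℕ (M ∸ j)) (2 *ℕ j))
  qc : 1-q^ (1 +ℕ 2 *ℕ M) ≈ one ⊖ q ⊗ (y′ ⊗ y)
  qc = 1-q^-≈ (≈-trans (mono-+ 1 (2 *ℕ M)) (⊗-congˡ q c≈y′y))
  previous : y ⊗ ((one ⊖ y′) ⊗ K) ≈ 1-q^ (2 *ℕ M) ⊗ rhsTerm (1 +ℕ M) j
  previous = begin
    y ⊗ (1-q^ (2 *ℕ (M ∸ j)) ⊗ K)              ≈⟨ ⊗-congˡ y (rhsBody-pred M j) ⟨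
    y ⊗ (1-q^ (2 *ℕ M) ⊗ rhsBody (M ∸ 1) j)    ≈⟨ solve 3 (λ y u K → y :* (u :* K) := u :* (y :* K)) ≈-refl y (1-q^ (2 *ℕ M)) (rhsBody (M ∸ 1) j) ⟩
    1-q^ (2 *ℕ M) ⊗ (y ⊗ rhsBody (M ∸ 1) j)    ≈⟨ ⊗-congˡ (1-q^ (2 *ℕ M)) (rhsTerm-body (1 +ℕ M) j) ⟨
    1-q^ (2 *ℕ M) ⊗ rhsTerm (1 +ℕ M) j         ∎
  exponent : ∀ j → 4 *ℕ j +ℕ 2 ≡ 2 *ℕ j +ℕ 2 *ℕ j +ℕ 1 +ℕ 1
  exponent = ℕ-Solver.solve-∀
  telescoper-suc : rhsTelescoper M (suc j) ≈ (one ⊖ y′) ⊗ ((y ⊗ y ⊗ q ⊗ q) ⊗ K)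
  telescoper-suc = ≈-trans (rhsTelescoper-suc M j) (⊗-congˡ (one ⊖ y′) (⊗-congʳ K
    (≈-trans (mono-cong (exponent j)) (≈-trans (mono-+ _ 1) (⊗-congʳ q (≈-trans (mono-+ _ 1) (⊗-congʳ q (mono-+ (2 *ℕ j) (2 *ℕ j)))))))))
  telescoper : rhsTelescoper M j ≈ ((one ⊖ q ⊗ y) ⊗ (one ⊖ q ⊗ y)) ⊗ K
  telescoper = ≈-trans (rhsTelescoper-body M j) (⊗-congʳ K (⊗-cong (1-q^-≈ (mono-+ 1 (2 *ℕ j))) (1-q^-≈ (mono-+ 1 (2 *ℕ j)))))

rhs-recurrence : Recurrence rhs
rhs-recurrence t = begin
  a ⊗ sumPS (suc t) (rhsTerm (2 +ℕ t))
    ≈⟨ ⊗-sumPS-telescope (suc t) a b (rhsTerm (1 +ℕ t)) (rhsTerm (2 +ℕ t)) G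
                         (λ j j<1+t → rhsTerm-recurrence t j (ℕ.≤-pred j<1+t)) ⟩
  b ⊗ sumPS (suc t) (rhsTerm (1 +ℕ t)) ⊕ (G (suc t) ⊖ G 0)
    ≈⟨ ⊕-cong (⊗-congˡ b (≈-sym (rhs-≈-sumPS t)))
              (⊕-cong (⊗-congˡ c (⊕-congˡ one (neg-cong (rhsTelescoper-vanish t))))
                      (neg-cong (⊗-congˡ c (⊕-congˡ one (neg-cong (rhsTelescoper-zero t)))))) ⟩
  b ⊗ rhs (1 +ℕ t) ⊕ (c ⊗ (one ⊖ zeroS) ⊖ c ⊗ (one ⊖ one))
    ≈⟨ ⊕-congˡ (b ⊗ rhs (1 +ℕ t)) (solve 1 (λ c → c :* (con 1ℤ :- con 0ℤ) :- c :* (con 1ℤ :- con 1ℤ) := c) ≈-refl c) ⟩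
  b ⊗ rhs (1 +ℕ t) ⊕ c ∎
  where
  open ≈-Reasoning
  a b c : PS
  a = 1-q^ (1 +ℕ 2 *ℕ t) ⊗ 1-q^ (1 +ℕ 2 *ℕ t)
  b = 1-q^ (2 *ℕ t)
  c = mono (2 *ℕ t)
  G : ℕ → PS
  G j = c ⊗ (one ⊖ rhsTelescoper t j)

lemma3p1 : (k : ℕ) → 2 ≤ k → (m : ℕ) → lhs k m ≡ rhs k m
lemma3p1 (suc (suc t)) _ = at (recurrence-unique {lhs} {rhs} lhs-recurrence rhs-recurrence t)
lemma3p1 1 (s≤s ())
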